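{- Let $n>3$ and let $C_n$ be the unweighted $n$-cycle with vertex set $\mathbb Z_n$ and shortest-path metric $d_{C_n}$. Let $f$ be the random embedding obtained by choosing an edge $\{a,a+1\}$ of $C_n$ uniformly at random, deleting it, and mapping $C_n$ identically onto the resulting path (with its shortest-path metric). Then $f$ is non-contractive and for every $x\in C_n$, $\mathbb{E}\left[|\nabla f(x)|_\infty\right]=\Theta(\log n)$, with implied constants independent of $n$ and $x$.
   Context: A map $f$ into a metric space $(Y,d_Y)$ is non-contractive if $d_Y(f(x),f(y))\ge d_{C_n}(x,y)$ for all $x,y$. The maximum gradient is $|\nabla f(x)|_\infty=\max_{y\ne x}\frac{d_Y(f(x),f(y))}{d_{C_n}(x,y)}$. -}

module Defs where

open import Data.Nat as ℕ using (ℕ; zero; suc; _+_; _∸_; _⊓_; ∣_-_∣)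
open import Data.Nat.DivMod using (_%_)
open import Data.Fin as Fin using (Fin; toℕ)
open import Data.List using (List; map; foldr; filter; allFin)
open import Data.Integer using (+_)
open import Data.Rational as ℚ using (ℚ; 0ℚ; _/_)
open import Relation.Nullary using (¬?)

ℕtoℚ : ℕ → ℚ
ℕtoℚ k = + k / 1

-- p / q as a rational; only used with q ≥ 1 (q = 0 gives 0, never used)
ratio : ℕ → ℕ → ℚ
ratio p zero = 0ℚ
ratio p (suc q) = + p / suc q

modN : ℕ → ℕ → ℕ
modN zero k = 0
modN (suc m) k = k % suc m

dC : (n : ℕ) → Fin n → Fin n → ℕ
dC n x y = ∣ toℕ x - toℕ y ∣ ⊓ (n ∸ ∣ toℕ x - toℕ y ∣)

-- After deleting the edge {a, a+1}, the path is a+1, a+2, ..., a (mod n);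
-- pos n a v is the position of v along this path (0 .. n-1).
pos : (n : ℕ) → Fin n → Fin n → ℕ
pos n a v = modN n (toℕ v + n ∸ suc (toℕ a))

-- shortest-path metric on the path obtained by deleting edge {a, a+1};
-- f_a is the identity on vertices, so this is d_Y(f_a x, f_a y)
dP : (n : ℕ) → Fin n → Fin n → Fin n → ℕ
dP n a x y = ∣ pos n a x - pos n a y ∣

-- |∇ f_a (x)|_∞ = max_{y ≠ x} dP(x,y) / dC(x,y)   (all ratios ≥ 0, so folding from 0 is the max)
grad : (n : ℕ) → Fin n → Fin n → ℚ
grad n a x = foldr ℚ._⊔_ 0ℚ
  (map (λ y → ratio (dP n a x y) (dC n x y)) (filter (λ y → ¬? (x Fin.≟ y)) (allFin n)))

sumℚ : List ℚ → ℚ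
sumℚ = foldr ℚ._+_ 0ℚ

recipN : ℕ → ℚ
recipN zero = 0ℚ
recipN (suc m) = + 1 / suc m

expGrad : (n : ℕ) → Fin n → ℚ
expGrad n x = recipN n ℚ.* sumℚ (map (λ a → grad n a x) (allFin n))

-- Cutting the cycle at the edge {a, a+1} rotates the labels: x sits at position
-- p = x − a − 1 (mod n) of the path, and the path distance of two vertices is either
-- their label difference e or n − e, so it dominates the cycle distance e ⊓ (n − e).
-- Every ratio d_P/d_C is then at most n/(p+1) + n/(n−p), while the far end a of the
-- path gives a ratio of at least (n−1−p)/(p+1). As a ranges over Z_n, p takes every
-- value once, so averaging yields H_n − 1 ≤ E|∇f(x)|∞ ≤ 2 H_n, and halving the
-- harmonic sum gives 1 + ⌊log₂ n⌋/2 ≤ H_n ≤ 1 + ⌊log₂ n⌋.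

module Submission where

open import Defs
open import Data.Nat as ℕ
  using (ℕ; zero; suc; _+_; _*_; _∸_; _≤_; _<_; _⊓_; ∣_-_∣; _%_; z≤n; s≤s; z<s; s<s; ⌊_/2⌋; ⌈_/2⌉)
open import Data.Nat.Properties hiding (+-cancelʳ-≤)
open import Data.Nat.Tactic.RingSolver using (solve-∀)
import Data.Integer as ℤ
import Data.Integer.Properties as ℤP
open import Data.Rational as ℚ using (ℚ; 0ℚ; 1ℚ; toℚᵘ)
import Data.Rational.Properties as ℚP
open import Data.Rational.Unnormalised as ℚᵘ using (mkℚᵘ; *≡*; *≤*)
import Data.Rational.Unnormalised.Properties as ℚᵘP
open import Data.Nat.Induction using (<-rec)
open import Data.Nat.Logarithm using (⌊log₂_⌋; ⌊log₂⌋-mono-≤; ⌊log₂⌊n/2⌋⌋≡⌊log₂n⌋∸1)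
open import Data.Nat.DivMod using (m%n<n; [m+n]%n≡m%n; m<n⇒m%n≡m)
open import Data.Fin as Fin using (Fin; toℕ)
open import Data.Fin.Properties using (toℕ<n)
open import Data.Product using (Σ; _×_; _,_)
open import Data.Sum using (_⊎_; inj₁; inj₂)
open import Data.Empty using (⊥-elim)
open import Relation.Nullary using (yes; no; ¬?)
open import Data.List using ([]; _∷_; map; foldr; filter; allFin; tabulate)
open import Data.List.Relation.Unary.All as All using (All; []; _∷_)
open import Data.List.Relation.Unary.All.Properties using (map⁺; filter⁺)
open import Data.List.Relation.Unary.Any using (here; there)
open import Data.List.Membership.Propositional using (_∈_)
open import Data.List.Membership.Propositional.Properties using (∈-map⁺; ∈-filter⁺; ∈-allFin)
open import Data.List.Properties using (map-tabulate)
open import Relation.Binary.PropositionalEquality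
open import Algebra.Bundles using (CommutativeMonoid)
open import Algebra.Properties.CommutativeSemigroup
  (CommutativeMonoid.commutativeSemigroup ℚP.+-0-commutativeMonoid) using (interchange)

p≤p+q : ∀ {p q} → 0ℚ ℚ.≤ q → p ℚ.≤ p ℚ.+ q
p≤p+q {p} {q} 0≤q = subst (ℚ._≤ p ℚ.+ q) (ℚP.+-identityʳ p) (ℚP.+-monoʳ-≤ p 0≤q)

p≤q+p : ∀ {p q} → 0ℚ ℚ.≤ q → p ℚ.≤ q ℚ.+ p
p≤q+p {p} {q} 0≤q = subst (ℚ._≤ q ℚ.+ p) (ℚP.+-identityˡ p) (ℚP.+-monoˡ-≤ p 0≤q)

+-cancelʳ-≤ : ∀ {p q} r → p ℚ.+ r ℚ.≤ q ℚ.+ r → p ℚ.≤ q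
+-cancelʳ-≤ {p} {q} r p+r≤q+r = subst₂ ℚ._≤_ (cancel p) (cancel q) (ℚP.+-monoˡ-≤ (ℚ.- r) p+r≤q+r)
  where
  cancel : ∀ z → z ℚ.+ r ℚ.+ ℚ.- r ≡ z
  cancel z = trans (ℚP.+-assoc z r (ℚ.- r)) (trans (cong (z ℚ.+_) (ℚP.+-inverseʳ r)) (ℚP.+-identityʳ z))

ratio-toℚᵘ : ∀ a b → toℚᵘ (ratio a (suc b)) ℚᵘ.≃ mkℚᵘ (ℤ.+ a) b
ratio-toℚᵘ a b = ℚP.toℚᵘ-fromℚᵘ (mkℚᵘ (ℤ.+ a) b)

ratio-mono-≤ : ∀ a b c d → 0 < b → 0 < d → a * d ≤ c * b → ratio a b ℚ.≤ ratio c d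
ratio-mono-≤ a (suc b) c (suc d) _ _ ad≤cb = ℚP.toℚᵘ-cancel-≤
  (ℚᵘP.≤-respˡ-≃ (ℚᵘP.≃-sym (ratio-toℚᵘ a b)) (ℚᵘP.≤-respʳ-≃ (ℚᵘP.≃-sym (ratio-toℚᵘ c d))
    (*≤* (subst₂ ℤ._≤_ (ℤP.pos-* a (suc d)) (ℤP.pos-* c (suc b)) (ℤ.+≤+ ad≤cb)))))

ratio-cong : ∀ a b c d → a * suc d ≡ c * suc b → ratio a (suc b) ≡ ratio c (suc d)
ratio-cong a b c d ad≡cb = ℚP.fromℚᵘ-cong {mkℚᵘ (ℤ.+ a) b} {mkℚᵘ (ℤ.+ c) d}
  (*≡* (trans (sym (ℤP.pos-* a (suc d))) (trans (cong ℤ.+_ ad≡cb) (ℤP.pos-* c (suc b)))))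

ratio-+ : ∀ a b c d →
  ratio a (suc b) ℚ.+ ratio c (suc d) ≡ ratio (a * suc d + c * suc b) (suc b * suc d)
ratio-+ a b c d = ℚP.toℚᵘ-injective (ℚᵘP.≃-trans (ℚP.toℚᵘ-homo-+ (ratio a (suc b)) (ratio c (suc d)))
  (ℚᵘP.≃-trans (ℚᵘP.+-cong (ratio-toℚᵘ a b) (ratio-toℚᵘ c d))
  (ℚᵘP.≃-trans (ℚᵘP.≃-reflexive (cong (λ z → mkℚᵘ z (ℕ.pred (suc b * suc d))) numerator))
    (ℚᵘP.≃-sym (ratio-toℚᵘ _ _)))))
  where
  numerator : ℤ.+ a ℤ.* ℤ.+ suc d ℤ.+ ℤ.+ c ℤ.* ℤ.+ suc b ≡ ℤ.+ (a * suc d + c * suc b)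
  numerator = trans (cong₂ ℤ._+_ (sym (ℤP.pos-* a (suc d))) (sym (ℤP.pos-* c (suc b))))
                    (sym (ℤP.pos-+ (a * suc d) (c * suc b)))

ratio-* : ∀ a b c d → ratio a (suc b) ℚ.* ratio c (suc d) ≡ ratio (a * c) (suc b * suc d)
ratio-* a b c d = ℚP.toℚᵘ-injective (ℚᵘP.≃-trans (ℚP.toℚᵘ-homo-* (ratio a (suc b)) (ratio c (suc d)))
  (ℚᵘP.≃-trans (ℚᵘP.*-cong (ratio-toℚᵘ a b) (ratio-toℚᵘ c d))
  (ℚᵘP.≃-trans (ℚᵘP.≃-reflexive (cong (λ z → mkℚᵘ z (ℕ.pred (suc b * suc d))) (sym (ℤP.pos-* a c))))
    (ℚᵘP.≃-sym (ratio-toℚᵘ _ _)))))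

ratio-homo-+ : ∀ a c b → ratio a (suc b) ℚ.+ ratio c (suc b) ≡ ratio (a + c) (suc b)
ratio-homo-+ a c b = trans (ratio-+ a b c b) (ratio-cong (a * suc b + c * suc b) (b + b * suc b) (a + c) b (cross a c b))
  where
  cross : ∀ a c b → (a * suc b + c * suc b) * suc b ≡ (a + c) * suc (b + b * suc b)
  cross = solve-∀

ℕtoℚ-homo-+ : ∀ a c → ℕtoℚ a ℚ.+ ℕtoℚ c ≡ ℕtoℚ (a + c)
ℕtoℚ-homo-+ a c = ratio-homo-+ a c 0

ℕtoℚ-*-ratio : ∀ m a b → ℕtoℚ m ℚ.* ratio a (suc b) ≡ ratio (m * a) (suc b)
ℕtoℚ-*-ratio m a b = trans (ratio-* m 0 a b) (ratio-cong (m * a) (b + 0 * suc b) (m * a) b (cross m a b))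
  where
  cross : ∀ m a b → m * a * suc b ≡ m * a * suc (b + 0 * suc b)
  cross = solve-∀

ratio-self : ∀ b → ratio (suc b) (suc b) ≡ 1ℚ
ratio-self b = ratio-cong (suc b) b 1 0 (*-comm (suc b) 1)

ratio-nonneg : ∀ a b → 0ℚ ℚ.≤ ratio a b
ratio-nonneg a zero    = ℚP.≤-refl
ratio-nonneg a (suc b) = ratio-mono-≤ 0 1 a (suc b) z<s z<s z≤n

ratio-zero : ∀ b → ratio 0 b ≡ 0ℚ
ratio-zero zero    = refl
ratio-zero (suc b) = ratio-cong 0 b 0 0 refl

ratio-mono : ∀ {a b c d} → a ≤ c → 0 < d → d ≤ b → ratio a b ℚ.≤ ratio c d
ratio-mono {a} {b} {c} {d} a≤c 0<d d≤b = ratio-mono-≤ a b c d (<-≤-trans 0<d d≤b) 0<d (*-mono-≤ a≤c d≤b)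

ℕtoℚ-mono-≤ : ∀ {a b} → a ≤ b → ℕtoℚ a ℚ.≤ ℕtoℚ b
ℕtoℚ-mono-≤ {a} {b} a≤b = ratio-mono-≤ a 1 b 1 z<s z<s (*-monoˡ-≤ 1 a≤b)

foldr-⊔-nonneg : ∀ l → 0ℚ ℚ.≤ foldr ℚ._⊔_ 0ℚ l
foldr-⊔-nonneg []      = ℚP.≤-refl
foldr-⊔-nonneg (q ∷ l) = ℚP.≤-trans (foldr-⊔-nonneg l) (ℚP.p≤q⊔p q _)

foldr-⊔-upper : ∀ {q} l → q ∈ l → q ℚ.≤ foldr ℚ._⊔_ 0ℚ l
foldr-⊔-upper (q ∷ l) (here refl)  = ℚP.p≤p⊔q q _
foldr-⊔-upper (r ∷ l) (there q∈l) = ℚP.≤-trans (foldr-⊔-upper l q∈l) (ℚP.p≤q⊔p r _)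

foldr-⊔-lub : ∀ {B} l → 0ℚ ℚ.≤ B → All (ℚ._≤ B) l → foldr ℚ._⊔_ 0ℚ l ℚ.≤ B
foldr-⊔-lub []      0≤B []            = 0≤B
foldr-⊔-lub (q ∷ l) 0≤B (q≤B ∷ l≤B) = ℚP.⊔-lub q≤B (foldr-⊔-lub l 0≤B l≤B)

∑< : ℕ → (ℕ → ℚ) → ℚ
∑< zero    f = 0ℚ
∑< (suc k) f = f 0 ℚ.+ ∑< k (λ i → f (suc i))

∑<-suc : ∀ k f → ∑< (suc k) f ≡ ∑< k f ℚ.+ f k
∑<-suc zero    f = trans (ℚP.+-identityʳ (f 0)) (sym (ℚP.+-identityˡ (f 0)))
∑<-suc (suc k) f = trans (cong (f 0 ℚ.+_) (∑<-suc k (λ i → f (suc i))))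
  (sym (ℚP.+-assoc (f 0) _ _))

∑<-split : ∀ j k f → ∑< (j + k) f ≡ ∑< j f ℚ.+ ∑< k (λ i → f (j + i))
∑<-split zero    k f = sym (ℚP.+-identityˡ _)
∑<-split (suc j) k f = trans (cong (f 0 ℚ.+_) (∑<-split j k (λ i → f (suc i))))
  (sym (ℚP.+-assoc (f 0) _ _))

∑<-cong : ∀ k {f g} → (∀ i → i < k → f i ≡ g i) → ∑< k f ≡ ∑< k g
∑<-cong zero    f≡g = refl
∑<-cong (suc k) f≡g = cong₂ ℚ._+_ (f≡g 0 z<s) (∑<-cong k (λ i i<k → f≡g (suc i) (s<s i<k)))

∑<-mono-≤ : ∀ k {f g} → (∀ i → i < k → f i ℚ.≤ g i) → ∑< k f ℚ.≤ ∑< k g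
∑<-mono-≤ zero    f≤g = ℚP.≤-refl
∑<-mono-≤ (suc k) f≤g = ℚP.+-mono-≤ (f≤g 0 z<s) (∑<-mono-≤ k (λ i i<k → f≤g (suc i) (s<s i<k)))

∑<-reverse : ∀ k f → ∑< k (λ i → f (k ∸ suc i)) ≡ ∑< k f
∑<-reverse zero    f = refl
∑<-reverse (suc k) f = trans (cong (f k ℚ.+_) (∑<-reverse k f))
  (trans (ℚP.+-comm (f k) (∑< k f)) (sym (∑<-suc k f)))

∑<-distrib-+ : ∀ k f g → ∑< k (λ i → f i ℚ.+ g i) ≡ ∑< k f ℚ.+ ∑< k g
∑<-distrib-+ zero    f g = sym (ℚP.+-identityˡ 0ℚ)
∑<-distrib-+ (suc k) f g = trans (cong (f 0 ℚ.+ g 0 ℚ.+_) (∑<-distrib-+ k (λ i → f (suc i)) (λ i → g (suc i))))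
  (interchange (f 0) (g 0) _ _)

∑<-distribˡ-* : ∀ k c f → ∑< k (λ i → c ℚ.* f i) ≡ c ℚ.* ∑< k f
∑<-distribˡ-* zero    c f = sym (ℚP.*-zeroʳ c)
∑<-distribˡ-* (suc k) c f = trans (cong (c ℚ.* f 0 ℚ.+_) (∑<-distribˡ-* k c (λ i → f (suc i))))
  (sym (ℚP.*-distribˡ-+ c (f 0) _))

invSuc : ℕ → ℚ
invSuc p = ratio 1 (suc p)

∑<-const : ∀ k b → ∑< k (λ _ → invSuc b) ≡ ratio k (suc b)
∑<-const zero    b = sym (ratio-zero (suc b))
∑<-const (suc k) b = trans (cong (invSuc b ℚ.+_) (∑<-const k b)) (ratio-homo-+ 1 k b)

-- Harmonic numbers

harmonic : ℕ → ℚ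
harmonic m = ∑< m invSuc

harmonicBlock : ℕ → ℕ → ℚ
harmonicBlock k b = ∑< b (λ i → invSuc (k + i))

harmonicBlock-≤ : ∀ k b → harmonicBlock k b ℚ.≤ ratio b (suc k)
harmonicBlock-≤ k b = begin
    harmonicBlock k b
      ≤⟨ ∑<-mono-≤ b (λ i _ → ratio-mono-≤ 1 (suc (k + i)) 1 (suc k) z<s z<s (*-monoʳ-≤ 1 (s≤s (m≤m+n k i)))) ⟩
    ∑< b (λ _ → invSuc k)
      ≡⟨ ∑<-const b k ⟩
    ratio b (suc k) ∎
  where open ℚP.≤-Reasoning

harmonicBlock-≥ : ∀ k b D → k + b ≤ suc D → ratio b (suc D) ℚ.≤ harmonicBlock k b
harmonicBlock-≥ k b D k+b≤1+D = begin
    ratio b (suc D)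
      ≡⟨ ∑<-const b D ⟨
    ∑< b (λ _ → invSuc D)
      ≤⟨ ∑<-mono-≤ b (λ i i<b → ratio-mono-≤ 1 (suc D) 1 (suc (k + i)) z<s z<s (*-monoʳ-≤ 1 (term≤ i i<b))) ⟩
    harmonicBlock k b ∎
  where
  open ℚP.≤-Reasoning
  term≤ : ∀ i → i < b → suc (k + i) ≤ suc D
  term≤ i i<b = ≤-trans (≤-reflexive (sym (+-suc k i))) (≤-trans (+-monoʳ-≤ k i<b) k+b≤1+D)

-- For m ≥ 2 the block lies between 1/2 and 1, which drives both logarithmic bounds.
harmonic-halve : ∀ m → harmonic m ≡ harmonic ⌊ m /2⌋ ℚ.+ harmonicBlock ⌊ m /2⌋ ⌈ m /2⌉
harmonic-halve m = trans (cong (λ z → ∑< z invSuc) (sym (⌊n/2⌋+⌈n/2⌉≡n m)))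
                         (∑<-split ⌊ m /2⌋ ⌈ m /2⌉ invSuc)

⌊log₂⌋-halve : ∀ n → ⌊log₂ suc (suc n) ⌋ ≡ suc ⌊log₂ ⌊ suc (suc n) /2⌋ ⌋
⌊log₂⌋-halve n = sym (trans (cong suc (⌊log₂⌊n/2⌋⌋≡⌊log₂n⌋∸1 (suc (suc n))))
                            (m+[n∸m]≡n (⌊log₂⌋-mono-≤ {2} {suc (suc n)} (s≤s (s≤s z≤n)))))

harmonic≤1+⌊log₂⌋ : ∀ m → 1 ≤ m → harmonic m ℚ.≤ ℕtoℚ (suc ⌊log₂ m ⌋)
harmonic≤1+⌊log₂⌋ = <-rec _ bound
  where
  bound : ∀ m → (∀ {k} → k < m → 1 ≤ k → harmonic k ℚ.≤ ℕtoℚ (suc ⌊log₂ k ⌋)) →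
          1 ≤ m → harmonic m ℚ.≤ ℕtoℚ (suc ⌊log₂ m ⌋)
  bound (suc zero)    _   _ = ℚP.≤-refl
  bound (suc (suc n)) rec _ = begin
      harmonic m
        ≡⟨ harmonic-halve m ⟩
      harmonic k ℚ.+ harmonicBlock k ⌈ m /2⌉
        ≤⟨ ℚP.+-mono-≤ (rec (⌊n/2⌋<n (suc n)) (s≤s z≤n)) block≤1 ⟩
      ℕtoℚ (suc ⌊log₂ k ⌋) ℚ.+ ℕtoℚ 1
        ≡⟨ ℕtoℚ-homo-+ (suc ⌊log₂ k ⌋) 1 ⟩
      ℕtoℚ (suc ⌊log₂ k ⌋ + 1)
        ≡⟨ cong ℕtoℚ (trans (+-comm (suc ⌊log₂ k ⌋) 1) (cong suc (sym (⌊log₂⌋-halve n)))) ⟩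
      ℕtoℚ (suc ⌊log₂ m ⌋) ∎
    where
    open ℚP.≤-Reasoning
    m = suc (suc n)
    k = ⌊ m /2⌋
    ⌈m/2⌉≤1+k : ⌈ m /2⌉ ≤ suc k
    ⌈m/2⌉≤1+k = ⌊n/2⌋-mono (n≤1+n (suc m))
    block≤1 : harmonicBlock k ⌈ m /2⌉ ℚ.≤ ℕtoℚ 1
    block≤1 = ℚP.≤-trans (harmonicBlock-≤ k ⌈ m /2⌉) (ratio-mono-≤ ⌈ m /2⌉ (suc k) 1 1 z<s z<s
      (subst₂ _≤_ (sym (*-identityʳ ⌈ m /2⌉)) (sym (*-identityˡ (suc k))) ⌈m/2⌉≤1+k))

2+⌊log₂⌋≤2harmonic : ∀ m → 1 ≤ m → ℕtoℚ (2 + ⌊log₂ m ⌋) ℚ.≤ harmonic m ℚ.+ harmonic m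
2+⌊log₂⌋≤2harmonic = <-rec _ bound
  where
  bound : ∀ m → (∀ {k} → k < m → 1 ≤ k → ℕtoℚ (2 + ⌊log₂ k ⌋) ℚ.≤ harmonic k ℚ.+ harmonic k) →
          1 ≤ m → ℕtoℚ (2 + ⌊log₂ m ⌋) ℚ.≤ harmonic m ℚ.+ harmonic m
  bound (suc zero)    _   _ = ℚP.≤-refl
  bound (suc (suc n)) rec _ = begin
      ℕtoℚ (2 + ⌊log₂ m ⌋)
        ≡⟨ cong ℕtoℚ (trans (cong (λ l → 2 + l) (⌊log₂⌋-halve n)) (+-comm 1 (2 + ⌊log₂ k ⌋))) ⟩
      ℕtoℚ (2 + ⌊log₂ k ⌋ + 1)
        ≡⟨ ℕtoℚ-homo-+ (2 + ⌊log₂ k ⌋) 1 ⟨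
      ℕtoℚ (2 + ⌊log₂ k ⌋) ℚ.+ (ratio 1 2 ℚ.+ ratio 1 2)
        ≤⟨ ℚP.+-mono-≤ (rec (⌊n/2⌋<n (suc n)) (s≤s z≤n)) (ℚP.+-mono-≤ half≤block half≤block) ⟩
      (harmonic k ℚ.+ harmonic k) ℚ.+ (block ℚ.+ block)
        ≡⟨ interchange (harmonic k) (harmonic k) block block ⟩
      (harmonic k ℚ.+ block) ℚ.+ (harmonic k ℚ.+ block)
        ≡⟨ cong₂ ℚ._+_ (harmonic-halve m) (harmonic-halve m) ⟨
      harmonic m ℚ.+ harmonic m ∎
    where
    open ℚP.≤-Reasoning
    m = suc (suc n)
    k = ⌊ m /2⌋
    block = harmonicBlock k ⌈ m /2⌉
    m≤2⌈m/2⌉ : 1 * m ≤ ⌈ m /2⌉ * 2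
    m≤2⌈m/2⌉ = subst₂ _≤_ (trans (⌊n/2⌋+⌈n/2⌉≡n m) (sym (*-identityˡ m))) (double ⌈ m /2⌉)
      (+-monoˡ-≤ ⌈ m /2⌉ (⌊n/2⌋≤⌈n/2⌉ m))
      where
      double : ∀ c → c + c ≡ c * 2
      double = solve-∀
    half≤block : ratio 1 2 ℚ.≤ block
    half≤block = ℚP.≤-trans (ratio-mono-≤ 1 2 ⌈ m /2⌉ m z<s z<s m≤2⌈m/2⌉)
                            (harmonicBlock-≥ k ⌈ m /2⌉ (suc n) (≤-reflexive (⌊n/2⌋+⌈n/2⌉≡n m)))

-- Distances on the cut cycle

EqualOrComplementary : ℕ → ℕ → ℕ → Set
EqualOrComplementary N d e = d ≡ e ⊎ d + e ≡ N

⊓-complement-cong : ∀ {N d e} → EqualOrComplementary N d e → e ⊓ (N ∸ e) ≡ d ⊓ (N ∸ d)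
⊓-complement-cong (inj₁ refl)  = refl
⊓-complement-cong {N} {d} {e} (inj₂ d+e≡N) = begin
    e ⊓ (N ∸ e)
      ≡⟨ cong (λ z → z ⊓ (N ∸ z)) e≡N∸d ⟩
    (N ∸ d) ⊓ (N ∸ (N ∸ d))
      ≡⟨ cong ((N ∸ d) ⊓_) (m∸[m∸n]≡n (subst (d ≤_) d+e≡N (m≤m+n d e))) ⟩
    (N ∸ d) ⊓ d
      ≡⟨ ⊓-comm (N ∸ d) d ⟩
    d ⊓ (N ∸ d) ∎
  where
  open ≡-Reasoning
  e≡N∸d : e ≡ N ∸ d
  e≡N∸d = trans (sym (m+n∸m≡n d e)) (cong (_∸ d) d+e≡N)

m<n+n⇒m%n≡m⊎n+m%n≡m : ∀ n {m} → m < suc n + suc n →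
  (m < suc n × m % suc n ≡ m) ⊎ (suc n + m % suc n ≡ m)
m<n+n⇒m%n≡m⊎n+m%n≡m n {m} m<2N with m <? suc n
... | yes m<N = inj₁ (m<N , m<n⇒m%n≡m m<N)
... | no  m≮N = inj₂ (trans (cong (N +_) m%N≡m∸N) (m+[n∸m]≡n N≤m))
  where
  N = suc n
  N≤m : N ≤ m
  N≤m = ≮⇒≥ m≮N
  m%N≡m∸N : m % N ≡ m ∸ N
  m%N≡m∸N = begin
      m % N                 ≡⟨ cong (_% N) (m∸n+n≡m N≤m) ⟨
      (m ∸ N + N) % N       ≡⟨ [m+n]%n≡m%n (m ∸ N) N ⟩
      (m ∸ N) % N           ≡⟨ m<n⇒m%n≡m (+-cancelˡ-< N (m ∸ N) N (subst (_< N + N) (sym (m+[n∸m]≡n N≤m)) m<2N)) ⟩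
      m ∸ N                 ∎
    where open ≡-Reasoning

rotate-≤ : ∀ n s {X Y} → Y ≤ X → X < suc n → s < suc n →
  EqualOrComplementary (suc n) ∣ (X + s) % suc n - (Y + s) % suc n ∣ ∣ X - Y ∣
rotate-≤ n s {X} {Y} Y≤X X<N s<N
  with m<n+n⇒m%n≡m⊎n+m%n≡m n (+-mono-< X<N s<N)
     | m<n+n⇒m%n≡m⊎n+m%n≡m n (+-mono-< (≤-<-trans Y≤X X<N) s<N)
... | inj₁ (_ , u%≡u) | inj₁ (_ , v%≡v) = inj₁ (begin
    ∣ (X + s) % N - (Y + s) % N ∣    ≡⟨ cong₂ ∣_-_∣ u%≡u v%≡v ⟩
    ∣ X + s - Y + s ∣                ≡⟨ cong₂ ∣_-_∣ (+-comm X s) (+-comm Y s) ⟩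
    ∣ s + X - s + Y ∣                ≡⟨ ∣m+n-m+o∣≡∣n-o∣ s X Y ⟩
    ∣ X - Y ∣                        ∎)
  where
  N = suc n
  open ≡-Reasoning
... | inj₂ N+u%≡u | inj₂ N+v%≡v = inj₁ (begin
    ∣ (X + s) % N - (Y + s) % N ∣               ≡⟨ ∣m+n-m+o∣≡∣n-o∣ N _ _ ⟨
    ∣ N + (X + s) % N - N + (Y + s) % N ∣       ≡⟨ cong₂ ∣_-_∣ N+u%≡u N+v%≡v ⟩
    ∣ X + s - Y + s ∣                           ≡⟨ cong₂ ∣_-_∣ (+-comm X s) (+-comm Y s) ⟩
    ∣ s + X - s + Y ∣                           ≡⟨ ∣m+n-m+o∣≡∣n-o∣ s X Y ⟩
    ∣ X - Y ∣                                   ∎)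
  where
  N = suc n
  open ≡-Reasoning
... | inj₁ (u<N , _) | inj₂ N+v%≡v =
  ⊥-elim (<⇒≱ u<N (≤-trans (m≤m+n (suc n) _) (≤-trans (≤-reflexive N+v%≡v) (+-monoˡ-≤ s Y≤X))))
... | inj₂ N+u%≡u | inj₁ (_ , v%≡v) = inj₂ (+-cancelˡ-≡ u′ _ _ (begin
    u′ + (∣ u′ - (Y + s) % N ∣ + ∣ X - Y ∣)
      ≡⟨ cong₂ (λ z w → u′ + (∣ u′ - z ∣ + w)) v%≡v (m≤n⇒∣n-m∣≡n∸m Y≤X) ⟩
    u′ + (∣ u′ - Y + s ∣ + (X ∸ Y))
      ≡⟨ cong (λ z → u′ + (z + (X ∸ Y))) (m≤n⇒∣m-n∣≡n∸m u′≤v) ⟩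
    u′ + ((Y + s ∸ u′) + (X ∸ Y))
      ≡⟨ +-assoc u′ _ (X ∸ Y) ⟨
    (u′ + (Y + s ∸ u′)) + (X ∸ Y)
      ≡⟨ cong (_+ (X ∸ Y)) (m+[n∸m]≡n u′≤v) ⟩
    Y + s + (X ∸ Y)
      ≡⟨ shift Y s (X ∸ Y) ⟩
    Y + (X ∸ Y) + s
      ≡⟨ cong (_+ s) (m+[n∸m]≡n Y≤X) ⟩
    X + s
      ≡⟨ N+u%≡u ⟨
    N + u′
      ≡⟨ +-comm N u′ ⟩
    u′ + N ∎))
  where
  N = suc n
  u′ = (X + s) % N
  open ≡-Reasoning
  u′≤v : u′ ≤ Y + s
  u′≤v = +-cancelˡ-≤ N u′ (Y + s) (≤-trans (≤-reflexive N+u%≡u)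
           (≤-trans (+-monoˡ-≤ s (≤-trans (<⇒≤ X<N) (m≤m+n N Y))) (≤-reflexive (+-assoc N Y s))))
  shift : ∀ a b c → a + b + c ≡ a + c + b
  shift = solve-∀

rotate : ∀ n s X Y → X < suc n → Y < suc n → s < suc n →
  EqualOrComplementary (suc n) ∣ (X + s) % suc n - (Y + s) % suc n ∣ ∣ X - Y ∣
rotate n s X Y X<N Y<N s<N with ≤-total Y X
... | inj₁ Y≤X = rotate-≤ n s Y≤X X<N s<N
... | inj₂ X≤Y = subst₂ (EqualOrComplementary (suc n))
  (∣-∣-comm ((Y + s) % suc n) ((X + s) % suc n)) (∣-∣-comm Y X) (rotate-≤ n s X≤Y Y<N s<N)

pos≡rotation : ∀ n (a v : Fin (suc n)) → pos (suc n) a v ≡ (toℕ v + (n ∸ toℕ a)) % suc n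
pos≡rotation n a v = cong (_% suc n) (+-∸-assoc (toℕ v) (toℕ<n a))

pos<n : ∀ n (a v : Fin n) → pos n a v < n
pos<n (suc n) a v = m%n<n (toℕ v + suc n ∸ suc (toℕ a)) (suc n)

pos-self : ∀ n (a : Fin (suc n)) → pos (suc n) a a ≡ n
pos-self n a = begin
    pos (suc n) a a                       ≡⟨ pos≡rotation n a a ⟩
    (toℕ a + (n ∸ toℕ a)) % suc n         ≡⟨ cong (_% suc n) (m+[n∸m]≡n (≤-pred (toℕ<n a))) ⟩
    n % suc n                             ≡⟨ m<n⇒m%n≡m (n<1+n n) ⟩
    n                                     ∎
  where open ≡-Reasoning

dP-equalOrComplementary : ∀ n (a x y : Fin (suc n)) →
  EqualOrComplementary (suc n) (dP (suc n) a x y) ∣ toℕ x - toℕ y ∣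
dP-equalOrComplementary n a x y =
  subst₂ (λ p q → EqualOrComplementary (suc n) ∣ p - q ∣ ∣ toℕ x - toℕ y ∣)
    (sym (pos≡rotation n a x)) (sym (pos≡rotation n a y))
    (rotate n (n ∸ toℕ a) (toℕ x) (toℕ y) (toℕ<n x) (toℕ<n y) (s≤s (m∸n≤m n (toℕ a))))

dC≡dP⊓[n∸dP] : ∀ n (a x y : Fin (suc n)) →
  dC (suc n) x y ≡ dP (suc n) a x y ⊓ (suc n ∸ dP (suc n) a x y)
dC≡dP⊓[n∸dP] n a x y = ⊓-complement-cong (dP-equalOrComplementary n a x y)

dC≤dP : ∀ n (a x y : Fin n) → dC n x y ≤ dP n a x y
dC≤dP (suc n) a x y = subst (_≤ dP (suc n) a x y) (sym (dC≡dP⊓[n∸dP] n a x y)) (m⊓n≤m _ _)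

-- The gradient for a fixed deleted edge

stretch : ℕ → ℕ → ℚ
stretch N d = ratio d (d ⊓ (N ∸ d))

∣m-n∣<o : ∀ {m n o} → m < o → n < o → ∣ m - n ∣ < o
∣m-n∣<o {m} {n} m<o n<o = ≤-<-trans (∣m-n∣≤m⊔n m n) (⊔-lub m<o n<o)

gradUpperBound : ℕ → ℕ → ℚ
gradUpperBound N p = ratio N (suc p) ℚ.+ ratio N (N ∸ p)

-- Once d > N ∸ d, the shorter arc of the cycle crosses the deleted edge, so its length
-- N ∸ d is at least N ∸ p (when q ≤ p) or p + 1 (when p ≤ q).
stretch-≤ : ∀ N p q → p < N → q < N → stretch N ∣ p - q ∣ ℚ.≤ gradUpperBound N p
stretch-≤ N p q p<N q<N with ∣ p - q ∣ ≤? N ∸ ∣ p - q ∣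
... | yes d≤N∸d rewrite m≤n⇒m⊓n≡m d≤N∸d =
  ℚP.≤-trans (ratio-self≤ ∣ p - q ∣) (p≤p+q (ratio-nonneg N (N ∸ p)))
  where
  ratio-self≤ : ∀ d → ratio d d ℚ.≤ ratio N (suc p)
  ratio-self≤ zero    = ratio-nonneg N (suc p)
  ratio-self≤ (suc d) = ratio-mono-≤ (suc d) (suc d) N (suc p) z<s z<s
    (subst (_≤ N * suc d) (*-comm (suc p) (suc d)) (*-monoˡ-≤ (suc d) p<N))
... | no d≰N∸d rewrite m≥n⇒m⊓n≡n (<⇒≤ (≰⇒> d≰N∸d)) with ≤-total q p
...   | inj₁ q≤p = ℚP.≤-trans (ratio-mono (<⇒≤ (∣m-n∣<o p<N q<N)) (m<n⇒0<n∸m p<N) (∸-monoʳ-≤ N d≤p))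
                              (p≤q+p (ratio-nonneg N (suc p)))
  where
  d≤p : ∣ p - q ∣ ≤ p
  d≤p = subst (_≤ p) (sym (m≤n⇒∣n-m∣≡n∸m q≤p)) (m∸n≤m p q)
...   | inj₂ p≤q = ℚP.≤-trans (ratio-mono (<⇒≤ (∣m-n∣<o p<N q<N)) z<s 1+p≤N∸d)
                              (p≤p+q (ratio-nonneg N (N ∸ p)))
  where
  1+p≤N∸d : suc p ≤ N ∸ ∣ p - q ∣
  1+p≤N∸d = subst (_≤ N ∸ ∣ p - q ∣) (m∸[m∸n]≡n p<N)
    (∸-monoʳ-≤ N (subst (_≤ N ∸ suc p) (sym (m≤n⇒∣m-n∣≡n∸m p≤q)) (∸-monoˡ-≤ (suc p) q<N)))

stretch-≥ : ∀ N d p → N ∸ d ≡ suc p → ratio d (suc p) ℚ.≤ stretch N d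
stretch-≥ N zero    p _ = ℚP.≤-reflexive (ratio-zero (suc p))
stretch-≥ N (suc d) p N∸d≡1+p rewrite N∸d≡1+p = ratio-mono {suc d} {suc p} {suc d} {suc (d ⊓ p)} ≤-refl z<s (m⊓n≤n (suc d) (suc p))

gradLowerBound : ℕ → ℕ → ℚ
gradLowerBound N p = ratio (N ∸ suc p) (suc p)

grad-entry≡stretch : ∀ n (a x y : Fin (suc n)) →
  ratio (dP (suc n) a x y) (dC (suc n) x y) ≡ stretch (suc n) (dP (suc n) a x y)
grad-entry≡stretch n a x y = cong (ratio (dP (suc n) a x y)) (dC≡dP⊓[n∸dP] n a x y)

grad≤gradUpperBound : ∀ n (a x : Fin (suc n)) →
  grad (suc n) a x ℚ.≤ gradUpperBound (suc n) (pos (suc n) a x)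
grad≤gradUpperBound n a x = foldr-⊔-lub _
  (ℚP.≤-trans (ratio-nonneg (suc n) (suc p)) (p≤p+q (ratio-nonneg (suc n) (suc n ∸ p))))
  (map⁺ (filter⁺ (λ y → ¬? (x Fin.≟ y)) (All.universal entry≤ (allFin (suc n)))))
  where
  p = pos (suc n) a x
  entry≤ : ∀ y → ratio (dP (suc n) a x y) (dC (suc n) x y) ℚ.≤ gradUpperBound (suc n) p
  entry≤ y = subst (ℚ._≤ _) (sym (grad-entry≡stretch n a x y))
    (stretch-≤ (suc n) p (pos (suc n) a y) (pos<n (suc n) a x) (pos<n (suc n) a y))

grad-nonneg : ∀ n (a x : Fin n) → 0ℚ ℚ.≤ grad n a x
grad-nonneg n a x = foldr-⊔-nonneg
  (map (λ y → ratio (dP n a x y) (dC n x y)) (filter (λ y → ¬? (x Fin.≟ y)) (allFin n)))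

-- Witnessed by y = a, the far end of the path: path distance n ∸ p, cycle distance ≤ p + 1.
gradLowerBound≤grad : ∀ n (a x : Fin (suc n)) →
  gradLowerBound (suc n) (pos (suc n) a x) ℚ.≤ grad (suc n) a x
gradLowerBound≤grad n a x with x Fin.≟ a
... | yes refl = subst (ℚ._≤ grad (suc n) a a) (sym lower≡0) (grad-nonneg (suc n) a a)
  where
  lower≡0 : gradLowerBound (suc n) (pos (suc n) a a) ≡ 0ℚ
  lower≡0 = trans (cong (λ p → ratio (n ∸ p) (suc p)) (pos-self n a))
                  (trans (cong (λ d → ratio d (suc n)) (n∸n≡0 n)) (ratio-zero (suc n)))
... | no x≢a = begin
    ratio (n ∸ p) (suc p)                   ≡⟨ cong (λ d → ratio d (suc p)) d≡n∸p ⟨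
    ratio d (suc p)                         ≤⟨ stretch-≥ (suc n) d p N∸d≡1+p ⟩
    stretch (suc n) d                       ≡⟨ grad-entry≡stretch n a x a ⟨
    ratio d (dC (suc n) x a)                ≤⟨ foldr-⊔-upper _ (∈-map⁺ _ (∈-filter⁺ (λ y → ¬? (x Fin.≟ y)) (∈-allFin a) x≢a)) ⟩
    grad (suc n) a x                        ∎
  where
  open ℚP.≤-Reasoning
  p = pos (suc n) a x
  d = dP (suc n) a x a
  p≤n : p ≤ n
  p≤n = ≤-pred (pos<n (suc n) a x)
  d≡n∸p : d ≡ n ∸ p
  d≡n∸p = trans (cong (λ q → ∣ p - q ∣) (pos-self n a)) (m≤n⇒∣m-n∣≡n∸m p≤n)
  N∸d≡1+p : suc n ∸ d ≡ suc p
  N∸d≡1+p = trans (cong (suc n ∸_) d≡n∸p) (trans (+-∸-assoc 1 (m∸n≤m n p)) (cong suc (m∸[m∸n]≡n p≤n)))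

-- Averaging over the deleted edge

sumℚ-tabulate : ∀ k (g : ℕ → ℚ) → sumℚ (tabulate {n = k} (λ i → g (toℕ i))) ≡ ∑< k g
sumℚ-tabulate zero    g = refl
sumℚ-tabulate (suc k) g = cong (g 0 ℚ.+_) (sumℚ-tabulate k (λ i → g (suc i)))

sumℚ-allFin : ∀ k (g : ℕ → ℚ) → sumℚ (map (λ i → g (toℕ i)) (allFin k)) ≡ ∑< k g
sumℚ-allFin k g = trans (cong sumℚ (map-tabulate {n = k} (λ i → i) (λ i → g (toℕ i)))) (sumℚ-tabulate k g)

sumℚ-map-mono-≤ : ∀ {A : Set} {f g : A → ℚ} l → (∀ a → f a ℚ.≤ g a) → sumℚ (map f l) ℚ.≤ sumℚ (map g l)
sumℚ-map-mono-≤ []      f≤g = ℚP.≤-refl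
sumℚ-map-mono-≤ (a ∷ l) f≤g = ℚP.+-mono-≤ (f≤g a) (sumℚ-map-mono-≤ l f≤g)

-- i ↦ (X − 1 − i) mod N reverses [0, X) and [X, N) separately.
∑<-reflect : ∀ n X → X < suc n → (g : ℕ → ℚ) →
  ∑< (suc n) (λ i → g ((X + suc n ∸ suc i) % suc n)) ≡ ∑< (suc n) g
∑<-reflect n X X<N g = begin
    ∑< N (λ i → g (r i))
      ≡⟨ cong (λ z → ∑< z (λ i → g (r i))) X+k≡N ⟨
    ∑< (X + k) (λ i → g (r i))
      ≡⟨ ∑<-split X k _ ⟩
    ∑< X (λ i → g (r i)) ℚ.+ ∑< k (λ j → g (r (X + j)))
      ≡⟨ cong₂ ℚ._+_ (∑<-cong X (λ i i<X → cong g (r-below i i<X)))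
                     (∑<-cong k (λ j j<k → cong g (r-above j j<k))) ⟩
    ∑< X (λ i → g (X ∸ suc i)) ℚ.+ ∑< k (λ j → g (X + (k ∸ suc j)))
      ≡⟨ cong₂ ℚ._+_ (∑<-reverse X g) (∑<-reverse k (λ j → g (X + j))) ⟩
    ∑< X g ℚ.+ ∑< k (λ j → g (X + j))
      ≡⟨ ∑<-split X k g ⟨
    ∑< (X + k) g
      ≡⟨ cong (λ z → ∑< z g) X+k≡N ⟩
    ∑< N g ∎
  where
  open ≡-Reasoning
  N = suc n
  k = N ∸ X
  r : ℕ → ℕ
  r i = (X + N ∸ suc i) % N
  X+k≡N : X + k ≡ N
  X+k≡N = m+[n∸m]≡n (<⇒≤ X<N)
  r-below : ∀ i → i < X → r i ≡ X ∸ suc i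
  r-below i i<X = begin
      (X + N ∸ suc i) % N     ≡⟨ cong (_% N) (+-∸-comm N i<X) ⟩
      (X ∸ suc i + N) % N     ≡⟨ [m+n]%n≡m%n (X ∸ suc i) N ⟩
      (X ∸ suc i) % N         ≡⟨ m<n⇒m%n≡m (≤-<-trans (m∸n≤m X (suc i)) X<N) ⟩
      X ∸ suc i               ∎
  r-above : ∀ j → j < k → r (X + j) ≡ X + (k ∸ suc j)
  r-above j j<k = begin
      (X + N ∸ suc (X + j)) % N     ≡⟨ cong (λ z → (X + N ∸ z) % N) (+-suc X j) ⟨
      (X + N ∸ (X + suc j)) % N     ≡⟨ cong (_% N) ([m+n]∸[m+o]≡n∸o X N (suc j)) ⟩
      (N ∸ suc j) % N               ≡⟨ m<n⇒m%n≡m (s≤s (m∸n≤m n j)) ⟩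
      N ∸ suc j                     ≡⟨ cong (_∸ suc j) X+k≡N ⟨
      X + k ∸ suc j                 ≡⟨ +-∸-assoc X j<k ⟩
      X + (k ∸ suc j)               ∎

∑-over-edges : ∀ n (x : Fin (suc n)) (g : ℕ → ℚ) →
  sumℚ (map (λ a → g (pos (suc n) a x)) (allFin (suc n))) ≡ ∑< (suc n) g
∑-over-edges n x g = trans (sumℚ-allFin (suc n) (λ i → g ((toℕ x + suc n ∸ suc i) % suc n)))
                           (∑<-reflect n (toℕ x) (toℕ<n x) g)

∑<-ratio-suc : ∀ m k → ∑< k (λ p → ratio m (suc p)) ≡ ℕtoℚ m ℚ.* harmonic k
∑<-ratio-suc m k = trans (∑<-cong k (λ p _ → sym (m*invSuc p))) (∑<-distribˡ-* k (ℕtoℚ m) invSuc)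
  where
  m*invSuc : ∀ p → ℕtoℚ m ℚ.* invSuc p ≡ ratio m (suc p)
  m*invSuc p = trans (ℕtoℚ-*-ratio m 1 p) (cong (λ z → ratio z (suc p)) (*-identityʳ m))

∑<-gradUpperBound : ∀ n →
  ∑< (suc n) (gradUpperBound (suc n)) ≡ ℕtoℚ (suc n) ℚ.* (harmonic (suc n) ℚ.+ harmonic (suc n))
∑<-gradUpperBound n = begin
    ∑< N (gradUpperBound N)
      ≡⟨ ∑<-distrib-+ N (λ p → ratio N (suc p)) (λ p → ratio N (N ∸ p)) ⟩
    ∑< N (λ p → ratio N (suc p)) ℚ.+ ∑< N (λ p → ratio N (N ∸ p))
      ≡⟨ cong (∑< N (λ p → ratio N (suc p)) ℚ.+_) (∑<-cong N (λ p p<N → cong (ratio N) (+-∸-assoc 1 (≤-pred p<N)))) ⟩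
    ∑< N (λ p → ratio N (suc p)) ℚ.+ ∑< N (λ p → ratio N (suc (N ∸ suc p)))
      ≡⟨ cong (∑< N (λ p → ratio N (suc p)) ℚ.+_) (∑<-reverse N (λ p → ratio N (suc p))) ⟩
    ∑< N (λ p → ratio N (suc p)) ℚ.+ ∑< N (λ p → ratio N (suc p))
      ≡⟨ cong₂ ℚ._+_ (∑<-ratio-suc N N) (∑<-ratio-suc N N) ⟩
    ℕtoℚ N ℚ.* harmonic N ℚ.+ ℕtoℚ N ℚ.* harmonic N
      ≡⟨ ℚP.*-distribˡ-+ (ℕtoℚ N) (harmonic N) (harmonic N) ⟨
    ℕtoℚ N ℚ.* (harmonic N ℚ.+ harmonic N) ∎
  where
  open ≡-Reasoning
  N = suc n

∑<-gradLowerBound : ∀ n →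
  ∑< (suc n) (gradLowerBound (suc n)) ℚ.+ ℕtoℚ (suc n) ≡ ℕtoℚ (suc n) ℚ.* harmonic (suc n)
∑<-gradLowerBound n = begin
    ∑< N (gradLowerBound N) ℚ.+ ℕtoℚ N
      ≡⟨ cong (∑< N (gradLowerBound N) ℚ.+_) ones ⟨
    ∑< N (gradLowerBound N) ℚ.+ ∑< N (λ _ → 1ℚ)
      ≡⟨ ∑<-distrib-+ N (gradLowerBound N) (λ _ → 1ℚ) ⟨
    ∑< N (λ p → gradLowerBound N p ℚ.+ 1ℚ)
      ≡⟨ ∑<-cong N (λ p p<N → lower+1 p (≤-pred p<N)) ⟩
    ∑< N (λ p → ratio N (suc p))
      ≡⟨ ∑<-ratio-suc N N ⟩
    ℕtoℚ N ℚ.* harmonic N ∎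
  where
  open ≡-Reasoning
  N = suc n
  ones : ∑< N (λ _ → 1ℚ) ≡ ℕtoℚ N
  ones = ∑<-const N 0
  lower+1 : ∀ p → p ≤ n → gradLowerBound N p ℚ.+ 1ℚ ≡ ratio N (suc p)
  lower+1 p p≤n = begin
      ratio (n ∸ p) (suc p) ℚ.+ 1ℚ                  ≡⟨ cong (ratio (n ∸ p) (suc p) ℚ.+_) (ratio-self p) ⟨
      ratio (n ∸ p) (suc p) ℚ.+ ratio (suc p) (suc p) ≡⟨ ratio-homo-+ (n ∸ p) (suc p) p ⟩
      ratio (n ∸ p + suc p) (suc p)                 ≡⟨ cong (λ z → ratio z (suc p)) (trans (+-suc (n ∸ p) p) (cong suc (m∸n+n≡m p≤n))) ⟩
      ratio N (suc p)                               ∎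

recipN-inverse : ∀ n → recipN (suc n) ℚ.* ℕtoℚ (suc n) ≡ 1ℚ
recipN-inverse n = begin
    recipN (suc n) ℚ.* ℕtoℚ (suc n)     ≡⟨ ℚP.*-comm (recipN (suc n)) (ℕtoℚ (suc n)) ⟩
    ℕtoℚ (suc n) ℚ.* ratio 1 (suc n)   ≡⟨ ℕtoℚ-*-ratio (suc n) 1 n ⟩
    ratio (suc n * 1) (suc n)          ≡⟨ cong (λ z → ratio z (suc n)) (*-identityʳ (suc n)) ⟩
    ratio (suc n) (suc n)              ≡⟨ ratio-self n ⟩
    1ℚ                                 ∎
  where open ≡-Reasoning

recipN-cancel : ∀ n q → recipN (suc n) ℚ.* (ℕtoℚ (suc n) ℚ.* q) ≡ q
recipN-cancel n q = trans (sym (ℚP.*-assoc (recipN (suc n)) (ℕtoℚ (suc n)) q))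
  (trans (cong (ℚ._* q) (recipN-inverse n)) (ℚP.*-identityˡ q))

module _ (n : ℕ) (x : Fin (suc n)) where

  private
    N = suc n
    gradSum = sumℚ (map (λ a → grad N a x) (allFin N))
    instance
      recipN-nonNeg : ℚ.NonNegative (recipN N)
      recipN-nonNeg = ℚP.normalize-nonNeg 1 N

  gradSum≤ : gradSum ℚ.≤ ℕtoℚ N ℚ.* (harmonic N ℚ.+ harmonic N)
  gradSum≤ = begin
      gradSum
        ≤⟨ sumℚ-map-mono-≤ (allFin N) (λ a → grad≤gradUpperBound n a x) ⟩
      sumℚ (map (λ a → gradUpperBound N (pos N a x)) (allFin N))
        ≡⟨ ∑-over-edges n x (gradUpperBound N) ⟩
      ∑< N (gradUpperBound N)
        ≡⟨ ∑<-gradUpperBound n ⟩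
      ℕtoℚ N ℚ.* (harmonic N ℚ.+ harmonic N) ∎
    where open ℚP.≤-Reasoning

  gradSum≥ : ℕtoℚ N ℚ.* harmonic N ℚ.≤ gradSum ℚ.+ ℕtoℚ N
  gradSum≥ = begin
      ℕtoℚ N ℚ.* harmonic N
        ≡⟨ ∑<-gradLowerBound n ⟨
      ∑< N (gradLowerBound N) ℚ.+ ℕtoℚ N
        ≡⟨ cong (ℚ._+ ℕtoℚ N) (∑-over-edges n x (gradLowerBound N)) ⟨
      sumℚ (map (λ a → gradLowerBound N (pos N a x)) (allFin N)) ℚ.+ ℕtoℚ N
        ≤⟨ ℚP.+-monoˡ-≤ (ℕtoℚ N) (sumℚ-map-mono-≤ (allFin N) (λ a → gradLowerBound≤grad n a x)) ⟩
      gradSum ℚ.+ ℕtoℚ N ∎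
    where open ℚP.≤-Reasoning

  expGrad≤2harmonic : expGrad N x ℚ.≤ harmonic N ℚ.+ harmonic N
  expGrad≤2harmonic = subst (expGrad N x ℚ.≤_) (recipN-cancel n _) (ℚP.*-monoˡ-≤-nonNeg (recipN N) gradSum≤)

  harmonic≤expGrad+1 : harmonic N ℚ.≤ expGrad N x ℚ.+ 1ℚ
  harmonic≤expGrad+1 = begin
      harmonic N
        ≡⟨ recipN-cancel n (harmonic N) ⟨
      recipN N ℚ.* (ℕtoℚ N ℚ.* harmonic N)
        ≤⟨ ℚP.*-monoˡ-≤-nonNeg (recipN N) gradSum≥ ⟩
      recipN N ℚ.* (gradSum ℚ.+ ℕtoℚ N)
        ≡⟨ ℚP.*-distribˡ-+ (recipN N) gradSum (ℕtoℚ N) ⟩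
      expGrad N x ℚ.+ recipN N ℚ.* ℕtoℚ N
        ≡⟨ cong (expGrad N x ℚ.+_) (recipN-inverse n) ⟩
      expGrad N x ℚ.+ 1ℚ ∎
    where open ℚP.≤-Reasoning

1≤⌊log₂⌋ : ∀ {n} → 3 < n → 1 ≤ ⌊log₂ n ⌋
1≤⌊log₂⌋ {n} 3<n = ⌊log₂⌋-mono-≤ {2} {n} (≤-trans (s≤s (s≤s z≤n)) (<⇒≤ 3<n))

expGrad≤4⌊log₂⌋ : ∀ n → 3 < n → (x : Fin n) → expGrad n x ℚ.≤ ℕtoℚ 4 ℚ.* ℕtoℚ ⌊log₂ n ⌋
expGrad≤4⌊log₂⌋ (suc n) 3<n x = begin
    expGrad N x
      ≤⟨ expGrad≤2harmonic n x ⟩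
    harmonic N ℚ.+ harmonic N
      ≤⟨ ℚP.+-mono-≤ H≤1+L H≤1+L ⟩
    ℕtoℚ (suc L) ℚ.+ ℕtoℚ (suc L)
      ≡⟨ ℕtoℚ-homo-+ (suc L) (suc L) ⟩
    ℕtoℚ (suc L + suc L)
      ≤⟨ ℕtoℚ-mono-≤ (2+2l≤4l L (1≤⌊log₂⌋ 3<n)) ⟩
    ℕtoℚ (4 * L)
      ≡⟨ ℕtoℚ-*-ratio 4 L 0 ⟨
    ℕtoℚ 4 ℚ.* ℕtoℚ L ∎
  where
  open ℚP.≤-Reasoning
  N = suc n
  L = ⌊log₂ N ⌋
  H≤1+L = harmonic≤1+⌊log₂⌋ N z<s
  2+2l≤4l : ∀ l → 1 ≤ l → suc l + suc l ≤ 4 * l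
  2+2l≤4l (suc l) _ = subst (suc (suc l) + suc (suc l) ≤_) (sym (split l)) (m≤m+n _ (l + l))
    where
    split : ∀ l → 4 * suc l ≡ (suc (suc l) + suc (suc l)) + (l + l)
    split = solve-∀

⌊log₂⌋≤2expGrad : ∀ n → 3 < n → (x : Fin n) → ℕtoℚ ⌊log₂ n ⌋ ℚ.≤ ℕtoℚ 2 ℚ.* expGrad n x
⌊log₂⌋≤2expGrad (suc n) _ x = subst (ℕtoℚ L ℚ.≤_) E+E≡2E (+-cancelʳ-≤ (ℕtoℚ 2) (begin
    ℕtoℚ L ℚ.+ ℕtoℚ 2
      ≡⟨ trans (ℕtoℚ-homo-+ L 2) (cong ℕtoℚ (+-comm L 2)) ⟩
    ℕtoℚ (2 + L)
      ≤⟨ 2+⌊log₂⌋≤2harmonic N z<s ⟩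
    harmonic N ℚ.+ harmonic N
      ≤⟨ ℚP.+-mono-≤ (harmonic≤expGrad+1 n x) (harmonic≤expGrad+1 n x) ⟩
    (E ℚ.+ 1ℚ) ℚ.+ (E ℚ.+ 1ℚ)
      ≡⟨ interchange E 1ℚ E 1ℚ ⟩
    (E ℚ.+ E) ℚ.+ ℕtoℚ 2 ∎))
  where
  open ℚP.≤-Reasoning
  N = suc n
  L = ⌊log₂ N ⌋
  E = expGrad N x
  E+E≡2E : E ℚ.+ E ≡ ℕtoℚ 2 ℚ.* E
  E+E≡2E = trans (cong₂ ℚ._+_ (sym (ℚP.*-identityˡ E)) (sym (ℚP.*-identityˡ E))) (sym (ℚP.*-distribʳ-+ E 1ℚ 1ℚ))

mainTheorem6 : ((n : ℕ) → 3 < n → (a x y : Fin n) → dC n x y ≤ dP n a x y)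
  × Σ ℕ (λ c₁ → Σ ℕ (λ c₂ → (0 < c₁) × (0 < c₂)
    × ((n : ℕ) → 3 < n → (x : Fin n)
        → (ℕtoℚ ⌊log₂ n ⌋ ℚ.≤ ℕtoℚ c₁ ℚ.* expGrad n x)
        × (expGrad n x ℚ.≤ ℕtoℚ c₂ ℚ.* ℕtoℚ ⌊log₂ n ⌋))))
mainTheorem6 = (λ n _ → dC≤dP n)
  , 2 , 4 , z<s , z<s
  , λ n 3<n x → ⌊log₂⌋≤2expGrad n 3<n x , expGrad≤4⌊log₂⌋ n 3<n x
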